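{- Let $(D,B_0)$ be a dimaze that is both $C^O$-free and $F^\infty$-free, and let $\mathcal Q$ be a linkage with set of initial vertices $S$ and set of terminal vertices $T$, such that there is no linkage from $S$ whose set of terminal vertices is a proper subset of $T$. Then the $\mathcal Q$-shifted dimaze $(D_1,B_1)$ is $F^\infty$-free.
   Context: A dimaze $(D,B_0)$ is a digraph $D$ (no loops/parallel edges) on vertex set $V$ with a set $B_0\subseteq V$ of sinks (exits). A linkage is a set of vertex-disjoint finite directed paths ending in $B_0$. $\mathcal Q$-shifted dimaze: define $\vec{\mathcal Q}:V\setminus T\to V\setminus S$ by $\vec{\mathcal Q}(v)=v$ if $v\notin V(\mathcal Q)$, otherwise $\vec{\mathcal Q}(v)=u$ where $(v,u)\in E(\mathcal Q)$. $D_1$ is obtained from $D$ by replacing each edge $(v,u)\in E(D)\setminus E(\mathcal Q)$ with $(\vec{\mathcal Q}(v),u)$ and each $(v,u)\in E(\mathcal Q)$ with $(u,v)$; $B_1=(B_0\setminus T)\cup S$. $C^O$: vertices $x_i$ ($i\ge1$), $y_i$ ($i\ge2$), edges $(x_i,x_{i+1})$ and $(x_i,y_i)$, exits $\{y_i\}$. $F^\infty$: vertices $v,v_i$ ($i\in\mathbb N$), edges $(v,v_i)$, exits $\{v_i\}$. A subdivision of a dimaze $(D,B_0)$ is obtained by adding $b_0$ with edges $(b,b_0)$, $b\in B_0$, subdividing edges to get $D''$, and taking $D''-b_0$ with exits the in-neighbourhood of $b_0$. A dimaze is $H$-free ($H\in\{C^O,F^\infty\}$) if no subdimaze (subdigraph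 with exit set contained in the exit set) is isomorphic to a subdivision of $H$. -}

module Defs where

open import Level using (0ℓ)
open import Data.Nat using (ℕ; suc; _<_)
open import Data.Product using (Σ; _×_; _,_)
open import Data.Sum using (_⊎_)
open import Data.Empty using (⊥)
open import Data.List using (List; _∷_)
open import Data.List.NonEmpty using (List⁺; toList; head; last)
open import Data.List.Relation.Unary.Linked using (Linked)
open import Data.List.Relation.Unary.Unique.Propositional using (Unique)
open import Data.List.Membership.Propositional using (_∈_)
open import Relation.Nullary using (¬_)
open import Relation.Binary.PropositionalEquality using (_≡_; _≢_)

module _ {V : Set} where

  _⊆_ : (V → Set) → (V → Set) → Set
  A ⊆ B = ∀ x → A x → B x

  IsPath : (V → V → Set) → List V → Set
  IsPath E xs = Linked E xs × Unique xs

  data _⇒_∈ₚ_ : V → V → List V → Set where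
    here  : ∀ {x y xs} → x ⇒ y ∈ₚ (x ∷ y ∷ xs)
    there : ∀ {x y z xs} → x ⇒ y ∈ₚ xs → x ⇒ y ∈ₚ (z ∷ xs)

  -- a dimaze: digraph given by an edge relation (so no parallel edges),
  -- without loops, whose exits are sinks
  record IsDimaze (E : V → V → Set) (B : V → Set) : Set where
    field
      loopless : ∀ v → ¬ E v v
      exitsSinks : ∀ b → B b → ∀ u → ¬ E b u

  record Linkage (E : V → V → Set) (B : V → Set) : Set₁ where
    field
      I : Set
      path : I → List⁺ V
      isPath : ∀ i → IsPath E (toList (path i))
      endsInExit : ∀ i → B (last (path i))
      disjoint : ∀ i j x → x ∈ toList (path i) → x ∈ toList (path j) → i ≡ j

  module _ {E : V → V → Set} {B : V → Set} (Q : Linkage E B) where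
    open Linkage Q

    Init : V → Set
    Init x = Σ I λ i → head (path i) ≡ x

    Ter : V → Set
    Ter x = Σ I λ i → last (path i) ≡ x

    VQ : V → Set
    VQ x = Σ I λ i → x ∈ toList (path i)

    EQ : V → V → Set
    EQ x y = Σ I λ i → x ⇒ y ∈ₚ toList (path i)

    -- graph of the map Q→ : V ∖ T → V ∖ S  (Shift v x  means  Q→(v) = x)
    Shift : V → V → Set
    Shift v x = (¬ VQ v × x ≡ v) ⊎ EQ v x

    ShiftedEdge : V → V → Set
    ShiftedEdge x y = (Σ V λ v → E v y × ¬ EQ v y × Shift v x) ⊎ EQ y x

    ShiftedExit : V → Set
    ShiftedExit x = (B x × ¬ Ter x) ⊎ Init x

  -- a subdimaze of (E , B) isomorphic to a subdivision of F^∞: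
  -- a centre v and infinitely many paths (of length ≥ 1) from v, pairwise
  -- disjoint apart from v, each ending in an exit
  record FInfSubdivision (E : V → V → Set) (B : V → Set) : Set where
    field
      centre : V
      branch : ℕ → List⁺ V          -- the path minus its first vertex `centre`
      isPath : ∀ i → IsPath E (centre ∷ toList (branch i))
      endsInExit : ∀ i → B (last (branch i))
      disjoint : ∀ i j x → x ∈ toList (branch i) → x ∈ toList (branch j) → i ≡ j

  -- a subdimaze of (E , B) isomorphic to a subdivision of C^O:
  -- a ray r₀ r₁ … (r₀ = x₁), branch vertices r (f 0) , r (f 1) , … (= x₂ , x₃ , …)
  -- strictly after r₀, and from each a path of length ≥ 1 to an exit, these
  -- paths meeting the ray only in their first vertex and pairwise disjoint
  record COSubdivision (E : V → V → Set) (B : V → Set) : Set where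
    field
      ray : ℕ → V
      rayInjective : ∀ m n → ray m ≡ ray n → m ≡ n
      rayEdges : ∀ n → E (ray n) (ray (suc n))
      pos : ℕ → ℕ
      posPositive : 0 < pos 0
      posIncreasing : ∀ n → pos n < pos (suc n)
      branch : ℕ → List⁺ V          -- the path minus its first vertex ray (pos i)
      isPath : ∀ i → IsPath E (ray (pos i) ∷ toList (branch i))
      endsInExit : ∀ i → B (last (branch i))
      offRay : ∀ i x n → x ∈ toList (branch i) → x ≢ ray n
      disjoint : ∀ i j x → x ∈ toList (branch i) → x ∈ toList (branch j) → i ≡ j

  FInfFree : (V → V → Set) → (V → Set) → Set
  FInfFree E B = ¬ FInfSubdivision E B

  COFree : (V → V → Set) → (V → Set) → Set
  COFree E B = ¬ COSubdivision E B

-- A branch of an F^∞-subdivision in the shifted dimaze is a D₁-path; as long as it avoids V(Q)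
-- it is also a D-path, and once it meets a path of Q we may instead follow that path of Q
-- forwards to its exit. Edges into the centre c of D₁ come from edges of D leaving the unique
-- w with Q→(w) = c, so w is a new centre. The rerouted branches may now share paths of Q, but
-- each uses at most one, and each vertex lies on at most one original branch, so a greedily
-- chosen infinite subfamily of them is pairwise disjoint: an F^∞-subdivision in D.
module Submission where

open import Defs
open import Level using (0ℓ)
open import Axiom.ExcludedMiddle using (ExcludedMiddle)
open import Data.Nat using (ℕ; zero; suc; _<_; _≤_; _⊔_; z≤n; s≤s)
open import Data.Nat.Properties
  using (≤-refl; ≤-trans; <-≤-trans; <⇒≤; <⇒≢; m≤n⇒m<n∨m≡n; m≤m⊔n; m≤n⊔m; <-cmp)
open import Data.Product using (Σ; _×_; _,_; proj₁; proj₂)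
open import Data.Sum using (_⊎_; inj₁; inj₂)
open import Data.Empty using (⊥; ⊥-elim)
open import Data.List using (List; []; _∷_; initLast; _∷ʳ′_)
open import Data.List.NonEmpty using (List⁺; _∷_; toList; head; tail; last)
import Data.List.Relation.Unary.Linked as Linked
open import Data.List.Relation.Unary.Linked using ([-]; _∷_)
open import Data.List.Relation.Unary.AllPairs as AllPairs using ([]; _∷_)
open import Data.List.Relation.Unary.All as All using ([]; _∷_)
open import Data.List.Relation.Unary.Unique.Propositional using (Unique)
open import Data.List.Relation.Unary.Any using (here; there)
open import Data.List.Membership.Propositional using (_∈_)
open import Relation.Nullary using (¬_; yes; no)
open import Relation.Binary using (tri<; tri≈; tri>)
open import Relation.Binary.PropositionalEquality using (_≡_; refl; sym; trans; subst)

module _ {V : Set} where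

  last-∷ : (x y : V) (ys : List V) → last (x ∷ y ∷ ys) ≡ last (y ∷ ys)
  last-∷ x y ys with initLast ys
  ... | [] = refl
  ... | _ ∷ʳ′ _ = refl

  isPath-tail : ∀ {R : V → V → Set} {x xs} → IsPath R (x ∷ xs) → IsPath R xs
  isPath-tail (lnk , u) = Linked.tail lnk , AllPairs.tail u

  suffixFrom : ∀ {x : V} {xs} → x ∈ xs → List V
  suffixFrom {xs = _ ∷ xs} (here _) = xs
  suffixFrom (there x∈xs) = suffixFrom x∈xs

  suffixFrom-isPath : ∀ {R : V → V → Set} {x xs} → IsPath R xs → (x∈xs : x ∈ xs) →
                      IsPath R (x ∷ suffixFrom x∈xs)
  suffixFrom-isPath p (here refl) = p
  suffixFrom-isPath p (there x∈xs) = suffixFrom-isPath (isPath-tail p) x∈xs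

  suffixFrom-⊆ : ∀ {x z : V} {xs} (x∈xs : x ∈ xs) → z ∈ x ∷ suffixFrom x∈xs → z ∈ xs
  suffixFrom-⊆ (here refl) z∈ = z∈
  suffixFrom-⊆ (there x∈xs) z∈ = there (suffixFrom-⊆ x∈xs z∈)

  last-suffixFrom : ∀ {x} (xs : List⁺ V) (x∈xs : x ∈ toList xs) →
                    last (x ∷ suffixFrom x∈xs) ≡ last xs
  last-suffixFrom (_ ∷ _) (here refl) = refl
  last-suffixFrom (h ∷ h′ ∷ t) (there x∈xs) =
    trans (last-suffixFrom (h′ ∷ t) x∈xs) (sym (last-∷ h h′ t))

  ⇒∈ₚ-target : ∀ {x y : V} {xs} → x ⇒ y ∈ₚ xs → y ∈ xs
  ⇒∈ₚ-target here = there (here refl)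
  ⇒∈ₚ-target (there p) = there (⇒∈ₚ-target p)

  ⇒∈ₚ∷-target : ∀ {x y a : V} {xs} → x ⇒ y ∈ₚ (a ∷ xs) → y ∈ xs
  ⇒∈ₚ∷-target here = here refl
  ⇒∈ₚ∷-target (there p) = ⇒∈ₚ-target p

  ⇒∈ₚ-source-unique : ∀ {v v′ c : V} {xs} → Unique xs →
                      v ⇒ c ∈ₚ xs → v′ ⇒ c ∈ₚ xs → v ≡ v′
  ⇒∈ₚ-source-unique _ here here = refl
  ⇒∈ₚ-source-unique (_ ∷ c∉ ∷ _) here (there p) = ⊥-elim (All.lookup c∉ (⇒∈ₚ∷-target p) refl)
  ⇒∈ₚ-source-unique (_ ∷ c∉ ∷ _) (there p) here = ⊥-elim (All.lookup c∉ (⇒∈ₚ∷-target p) refl)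
  ⇒∈ₚ-source-unique (_ ∷ u) (there p) (there q) = ⇒∈ₚ-source-unique u p q

stepwise-mono-≤ : (f : ℕ → ℕ) → (∀ n → f n ≤ f (suc n)) → ∀ {m n} → m ≤ n → f m ≤ f n
stepwise-mono-≤ f step {n = zero} z≤n = ≤-refl
stepwise-mono-≤ f step {n = suc n} m≤1+n with m≤n⇒m<n∨m≡n m≤1+n
... | inj₁ (s≤s m≤n) = ≤-trans (stepwise-mono-≤ f step m≤n) (step n)
... | inj₂ refl = ≤-refl

module Sparse (em : ExcludedMiddle 0ℓ) {V : Set} (P : ℕ → V → Set)
              (disjoint : ∀ i j y → P i y → P j y → i ≡ j) where

  AvoidsFrom : ℕ → List V → Set
  AvoidsFrom N ys = ∀ k → N ≤ k → ∀ {y} → y ∈ ys → ¬ P k y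

  eventuallyAvoids-single : (y : V) → Σ ℕ λ N → ∀ k → N ≤ k → ¬ P k y
  eventuallyAvoids-single y with em {Σ ℕ λ i → P i y}
  ... | yes (i , Piy) = suc i , λ k i<k Pky → <⇒≢ i<k (disjoint i k y Piy Pky)
  ... | no ¬∃ = 0 , λ k _ Pky → ¬∃ (k , Pky)

  eventuallyAvoids : (ys : List V) → Σ ℕ λ N → AvoidsFrom N ys
  eventuallyAvoids [] = 0 , λ _ _ ()
  eventuallyAvoids (y ∷ ys) with eventuallyAvoids-single y | eventuallyAvoids ys
  ... | Ny , avoid-y | Nys , avoid-ys = Ny ⊔ Nys , avoid
    where
      avoid : AvoidsFrom (Ny ⊔ Nys) (y ∷ ys)
      avoid k N≤k (here refl) = avoid-y k (≤-trans (m≤m⊔n Ny Nys) N≤k)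
      avoid k N≤k (there y∈ys) = avoid-ys k (≤-trans (m≤n⊔m Ny Nys) N≤k) y∈ys

  record SparseSubsequence (initial : List V) (used : ℕ → List V) : Set where
    field
      index : ℕ → ℕ
      increasing : ∀ {a b} → a < b → index a < index b
      avoidsInitial : ∀ b {y} → y ∈ initial → ¬ P (index b) y
      avoidsEarlier : ∀ {a b} → a < b → ∀ {y} → y ∈ used (index a) → ¬ P (index b) y

  sparseSubsequence : (initial : List V) (used : ℕ → List V) → SparseSubsequence initial used
  sparseSubsequence initial used = record
    { index = index
    ; increasing = λ {a} a<b → <-≤-trans (step a) (mono a<b)
    ; avoidsInitial = λ b → proj₂ (eventuallyAvoids initial) (index b) (mono {n = b} z≤n)
    ; avoidsEarlier = λ {a} {b} a<b →
        proj₂ (eventuallyAvoids (used (index a))) (index b) (≤-trans (m≤n⊔m _ _) (mono a<b))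
    }
    where
      index : ℕ → ℕ
      index zero = proj₁ (eventuallyAvoids initial)
      index (suc n) = suc (index n) ⊔ proj₁ (eventuallyAvoids (used (index n)))

      step : ∀ n → index n < index (suc n)
      step n = m≤m⊔n (suc (index n)) (proj₁ (eventuallyAvoids (used (index n))))

      mono : ∀ {m n} → m ≤ n → index m ≤ index n
      mono = stepwise-mono-≤ index (λ n → <⇒≤ (step n))

module Rerouting (em : ExcludedMiddle 0ℓ) {V : Set} {E : V → V → Set} {B₀ : V → Set}
                 (Q : Linkage E B₀) where

  module Q = Linkage Q

  vertices : Q.I → List V
  vertices j = toList (Q.path j)

  shift-injective : ∀ {v v′ c} → Shift Q v c → Shift Q v′ c → v ≡ v′
  shift-injective (inj₁ (_ , refl)) (inj₁ (_ , refl)) = refl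
  shift-injective (inj₁ (v∉Q , refl)) (inj₂ (j , p)) = ⊥-elim (v∉Q (j , ⇒∈ₚ-target p))
  shift-injective (inj₂ (j , p)) (inj₁ (v∉Q , refl)) = ⊥-elim (v∉Q (j , ⇒∈ₚ-target p))
  shift-injective {c = c} (inj₂ (j , p)) (inj₂ (j′ , p′))
    with Q.disjoint j j′ c (⇒∈ₚ-target p) (⇒∈ₚ-target p′)
  ... | refl = ⇒∈ₚ-source-unique (proj₂ (Q.isPath j)) p p′

  shiftedEdge-preimage : ∀ {c u} → ShiftedEdge Q c u →
                         Σ V λ w → Shift Q w c × (E w u ⊎ u ≡ w)
  shiftedEdge-preimage (inj₁ (v , e , _ , s)) = v , s , inj₁ e
  shiftedEdge-preimage {u = u} (inj₂ q) = u , inj₂ q , inj₂ refl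

  shiftedEdge-offQ : ∀ {x y} → ¬ VQ Q x → ShiftedEdge Q x y → E x y
  shiftedEdge-offQ x∉Q (inj₁ (_ , e , _ , inj₁ (_ , refl))) = e
  shiftedEdge-offQ x∉Q (inj₁ (_ , _ , _ , inj₂ (j , p))) = ⊥-elim (x∉Q (j , ⇒∈ₚ-target p))
  shiftedEdge-offQ x∉Q (inj₂ (j , p)) = ⊥-elim (x∉Q (j , ⇒∈ₚ-target p))

  shiftedExit-offQ : ∀ {x} → ¬ VQ Q x → ShiftedExit Q x → B₀ x
  shiftedExit-offQ x∉Q (inj₁ (b , _)) = b
  shiftedExit-offQ x∉Q (inj₂ (j , refl)) = ⊥-elim (x∉Q (j , here refl))

  pathThrough : V → List V
  pathThrough w with em {VQ Q w}
  ... | yes (j , _) = vertices j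
  ... | no _ = []

  pathThrough-complete : ∀ {w y} j → w ∈ vertices j → y ∈ vertices j → y ∈ pathThrough w
  pathThrough-complete {w} j w∈j y∈j with em {VQ Q w}
  ... | yes (j′ , w∈j′) with Q.disjoint j j′ w w∈j w∈j′
  ...   | refl = y∈j
  pathThrough-complete j w∈j y∈j | no w∉Q = ⊥-elim (w∉Q (j , w∈j))

  OnQPathMeeting : List V → List V → V → Set
  OnQPathMeeting xs used z =
    Σ Q.I λ j → z ∈ vertices j × (∀ {y} → y ∈ vertices j → y ∈ used) ×
                Σ V λ y → y ∈ xs × y ∈ vertices j

  -- A D-path from x to B₀ replacing the D₁-path x ∷ xs; `used` lists the path of Q it
  -- finishes along, if any.
  record Detour (x : V) (xs : List V) : Set where
    field
      route : List V
      used : List V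
      isPath : IsPath E (x ∷ route)
      endsInExit : B₀ (last (x ∷ route))
      covered : ∀ {z} → z ∈ x ∷ route → (z ∈ x ∷ xs × ¬ VQ Q z) ⊎ OnQPathMeeting (x ∷ xs) used z

  detour : ∀ x xs → IsPath (ShiftedEdge Q) (x ∷ xs) → ShiftedExit Q (last (x ∷ xs)) → Detour x xs
  detour x xs p ex with em {VQ Q x}
  ... | yes (j , x∈j) = record
    { route = suffixFrom x∈j
    ; used = vertices j
    ; isPath = suffixFrom-isPath (Q.isPath j) x∈j
    ; endsInExit = subst B₀ (sym (last-suffixFrom (Q.path j) x∈j)) (Q.endsInExit j)
    ; covered = λ z∈ → inj₂ (j , suffixFrom-⊆ x∈j z∈ , (λ y∈j → y∈j) , x , here refl , x∈j)
    }
  detour x [] p ex | no x∉Q = record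
    { route = []
    ; used = []
    ; isPath = [-] , [] ∷ []
    ; endsInExit = shiftedExit-offQ x∉Q ex
    ; covered = λ { (here refl) → inj₁ (here refl , x∉Q) }
    }
  detour x (y ∷ ys) p@(e ∷ _ , x∉ys ∷ _) ex | no x∉Q = record
    { route = y ∷ D.route
    ; used = D.used
    ; isPath = shiftedEdge-offQ x∉Q e ∷ proj₁ D.isPath , All.tabulate x≢ ∷ proj₂ D.isPath
    ; endsInExit = subst B₀ (sym (last-∷ x y D.route)) D.endsInExit
    ; covered = λ { (here refl) → inj₁ (here refl , x∉Q)
                  ; (there z∈) → widen (D.covered z∈) }
    }
    where
      module D = Detour (detour y ys (isPath-tail p) (subst (ShiftedExit Q) (last-∷ x y ys) ex))

      x≢ : ∀ {z} → z ∈ y ∷ D.route → ¬ x ≡ z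
      x≢ z∈ refl with D.covered z∈
      ... | inj₁ (x∈ys , _) = All.lookup x∉ys x∈ys refl
      ... | inj₂ (j , x∈j , _) = x∉Q (j , x∈j)

      widen : ∀ {z} → (z ∈ y ∷ ys × ¬ VQ Q z) ⊎ OnQPathMeeting (y ∷ ys) D.used z →
              (z ∈ x ∷ y ∷ ys × ¬ VQ Q z) ⊎ OnQPathMeeting (x ∷ y ∷ ys) D.used z
      widen (inj₁ (z∈ , z∉Q)) = inj₁ (there z∈ , z∉Q)
      widen (inj₂ (j , z∈j , j⊆ , y′ , y′∈ , y′∈j)) = inj₂ (j , z∈j , j⊆ , y′ , there y′∈ , y′∈j)

  -- The centre of F is c = Q→(w); w becomes the centre of the subdivision in D.
  module Unshift (F : FInfSubdivision (ShiftedEdge Q) (ShiftedExit Q)) where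
    module F = FInfSubdivision F

    OnBranch : ℕ → V → Set
    OnBranch k y = y ∈ toList (F.branch k)

    D : (k : ℕ) → Detour (head (F.branch k)) (tail (F.branch k))
    D k = detour (head (F.branch k)) (tail (F.branch k)) (isPath-tail (F.isPath k)) (F.endsInExit k)
    module D k = Detour (D k)

    w : V
    w = proj₁ (shiftedEdge-preimage (Linked.head (proj₁ (F.isPath 0))))

    w-shift : Shift Q w F.centre
    w-shift = proj₁ (proj₂ (shiftedEdge-preimage (Linked.head (proj₁ (F.isPath 0)))))

    open Sparse em OnBranch F.disjoint
    open SparseSubsequence (sparseSubsequence (w ∷ pathThrough w) D.used)

    newBranch : ℕ → List⁺ V
    newBranch n = head (F.branch (index n)) ∷ D.route (index n)

    centreEdge : ∀ n → E w (head (newBranch n))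
    centreEdge n with shiftedEdge-preimage (Linked.head (proj₁ (F.isPath (index n))))
    ... | w′ , s , e with shift-injective s w-shift
    ...   | refl with e
    ...     | inj₁ e′ = e′
    ...     | inj₂ u≡w = ⊥-elim (avoidsInitial n (here u≡w) (here refl))

    centre∉newBranch : ∀ n → ¬ w ∈ toList (newBranch n)
    centre∉newBranch n w∈ with D.covered (index n) w∈
    ... | inj₁ (w∈branch , _) = avoidsInitial n (here refl) w∈branch
    ... | inj₂ (j , w∈j , _ , y , y∈branch , y∈j) =
      avoidsInitial n (there (pathThrough-complete j w∈j y∈j)) y∈branch

    newBranches-separated : ∀ {a b} → a < b → ∀ {y} →
                            y ∈ toList (newBranch a) → y ∈ toList (newBranch b) → ⊥
    newBranches-separated {a} {b} a<b {y} ya yb with D.covered (index a) ya | D.covered (index b) yb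
    ... | inj₁ (ya′ , _) | inj₁ (yb′ , _) =
      <⇒≢ (increasing a<b) (F.disjoint (index a) (index b) y ya′ yb′)
    ... | inj₁ (_ , y∉Q) | inj₂ (j , y∈j , _) = y∉Q (j , y∈j)
    ... | inj₂ (j , y∈j , _) | inj₁ (_ , y∉Q) = y∉Q (j , y∈j)
    ... | inj₂ (j , y∈j , j⊆used , _) | inj₂ (j′ , y∈j′ , _ , z , z∈b , z∈j′)
      with Q.disjoint j j′ y y∈j y∈j′
    ...   | refl = avoidsEarlier a<b (j⊆used z∈j′) z∈b

    newBranches-disjoint : ∀ a b y → y ∈ toList (newBranch a) → y ∈ toList (newBranch b) → a ≡ b
    newBranches-disjoint a b y ya yb with <-cmp a b
    ... | tri< a<b _ _ = ⊥-elim (newBranches-separated a<b ya yb)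
    ... | tri≈ _ a≡b _ = a≡b
    ... | tri> _ _ b<a = ⊥-elim (newBranches-separated b<a yb ya)

    subdivision : FInfSubdivision E B₀
    subdivision = record
      { centre = w
      ; branch = newBranch
      ; isPath = λ n → centreEdge n ∷ proj₁ (D.isPath (index n))
                     , All.tabulate (λ y∈ w≡y → centre∉newBranch n (subst (_∈ _) (sym w≡y) y∈))
                       ∷ proj₂ (D.isPath (index n))
      ; endsInExit = λ n → D.endsInExit (index n)
      ; disjoint = newBranches-disjoint
      }

shift-preserves-FInfFree : ExcludedMiddle 0ℓ → {V : Set} {E : V → V → Set} {B₀ : V → Set} →
                           (Q : Linkage E B₀) → FInfFree E B₀ →
                           FInfFree (ShiftedEdge Q) (ShiftedExit Q)
shift-preserves-FInfFree em Q free F = free (Rerouting.Unshift.subdivision em Q F)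

corollary2p9 : ExcludedMiddle 0ℓ →
    {V : Set} (E : V → V → Set) (B₀ : V → Set) →
    IsDimaze E B₀ → COFree E B₀ → FInfFree E B₀ →
    (Q : Linkage E B₀) →
    ((L : Linkage E B₀) →
      ((x : V) → (Init L x → Init Q x) × (Init Q x → Init L x)) →
      Ter L ⊆ Ter Q → ¬ (Ter Q ⊆ Ter L) → ⊥) →
    FInfFree (ShiftedEdge Q) (ShiftedExit Q)
corollary2p9 em E B₀ _ _ free Q _ = shift-preserves-FInfFree em Q free
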